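{- Let $S$ be a semigroup. If $\mathcal{I}n(S)$ is disconnected, then $\mathcal{I}n(S)$ has no edges.
   Context: A left ideal of a semigroup $S$ is a non-empty subset $I$ with $SI\subseteq I$; it is nontrivial if $I\neq S$. The inclusion ideal graph $\mathcal{I}n(S)$ is the simple undirected graph whose vertices are the nontrivial left ideals of $S$, with distinct $I,J$ adjacent iff $I\subset J$ or $J\subset I$. -}

module Defs where

open import Level using (Level; _⊔_; suc)
open import Algebra.Bundles using (Semigroup)
open import Data.Product using (Σ; _×_; _,_; ∃)
open import Data.Sum using (_⊎_)
open import Relation.Nullary using (¬_)
open import Relation.Binary.Construct.Closure.ReflexiveTransitive using (Star)

module _ {c ℓ : Level} (S : Semigroup c ℓ) where
  open Semigroup S

  record Subset : Set (suc (c ⊔ ℓ)) where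
    field
      mem  : Carrier → Set (c ⊔ ℓ)
      resp : ∀ {x y} → x ≈ y → mem x → mem y
  open Subset public

  _⊆_ : Subset → Subset → Set (c ⊔ ℓ)
  A ⊆ B = ∀ x → mem A x → mem B x

  _≐_ : Subset → Subset → Set (c ⊔ ℓ)
  A ≐ B = (A ⊆ B) × (B ⊆ A)

  _⊂_ : Subset → Subset → Set (c ⊔ ℓ)
  A ⊂ B = (A ⊆ B) × ¬ (A ≐ B)

  whole : Subset
  whole = record { mem = λ _ → Level.Lift (c ⊔ ℓ) Data.Unit.⊤ ; resp = λ _ t → t }
    where import Data.Unit

  IsLeftIdeal : Subset → Set (c ⊔ ℓ)
  IsLeftIdeal I = (∃ λ x → mem I x) × (∀ s x → mem I x → mem I (s ∙ x))

  record Vertex : Set (suc (c ⊔ ℓ)) where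
    constructor vertex
    field
      ideal      : Subset
      isLeftId   : IsLeftIdeal ideal
      nontrivial : ¬ (ideal ≐ whole)
  open Vertex public

  Adj : Vertex → Vertex → Set (c ⊔ ℓ)
  Adj I J = ¬ (ideal I ≐ ideal J) × ((ideal I ⊂ ideal J) ⊎ (ideal J ⊂ ideal I))

  Path : Vertex → Vertex → Set (suc (c ⊔ ℓ))
  Path = Star Adj

  Disconnected : Set (suc (c ⊔ ℓ))
  Disconnected = Σ Vertex λ u → Σ Vertex λ v → ¬ Path u v

  NoEdges : Set (suc (c ⊔ ℓ))
  NoEdges = ∀ (u v : Vertex) → ¬ Adj u v

{-# OPTIONS --safe #-}
module Submission where

-- Suppose I ⊂ J is an edge; we show every vertex W is joined to I by a path. If
-- U = W ∪ I is a proper left ideal, then W ⊆ U, and U has a neighbour (I, or J when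
-- U = I); a vertex contained in a vertex with a neighbour is connected to it. If
-- W ∪ I = S, then J ∩ W is non-empty (otherwise J ⊆ I), and W ⊃ J ∩ W ⊂ J ⊃ I is a
-- path, both inclusions being strict because W and J are proper. Case distinctions
-- are made under double negation, which suffices because the goal is ⊥.

open import Level using (Level; _⊔_; suc; lift)
open import Algebra.Bundles using (Semigroup)
open import Data.Product using (_×_; _,_; proj₁; proj₂; map₂)
open import Data.Sum using (_⊎_; inj₁; inj₂; [_,_])
import Data.Sum as Sum
open import Data.Empty using (⊥; ⊥-elim)
open import Function using (_∘_; id)
open import Relation.Nullary using (¬_; Dec; yes; no)
open import Relation.Nullary.Decidable using (¬¬-excluded-middle)
open import Relation.Nullary.Negation using (contradiction)
open import Relation.Unary using (Pred; _⊆′_; _≐′_; _∪_; _∩_; Satisfiable)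
open import Relation.Unary.Properties using (⊆′-trans; ≐′-sym; ≐′-trans)
open import Relation.Binary.Construct.Closure.ReflexiveTransitive using (_◅◅_; reverse)
open import Relation.Binary.Construct.Closure.ReflexiveTransitive.Properties using (module StarReasoning)
open import Defs using (Subset; mem; resp; whole; Vertex; vertex; ideal; isLeftId; nontrivial; Adj; Path; Disconnected; NoEdges)

byCases : ∀ {a b} {P : Set a} {B : Set b} → (Dec P → ¬ ¬ B) → ¬ ¬ B
byCases f ¬b = ¬¬-excluded-middle (λ d → f d ¬b)

module InclusionIdealGraph {c ℓ : Level} (S : Semigroup c ℓ) where
  open Semigroup S using (Carrier; _∙_)

  private variable
    P Q R : Pred Carrier (c ⊔ ℓ)

  -- Defs' _⊆_, _≐_, _⊂_ and Adj unfold to the following relations between the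
  -- membership predicates; stated for predicates, their arguments can be inferred.
  infix 4 _⊊_
  _⊊_ : Pred Carrier (c ⊔ ℓ) → Pred Carrier (c ⊔ ℓ) → Set (c ⊔ ℓ)
  P ⊊ Q = P ⊆′ Q × ¬ (P ≐′ Q)

  Comparable : Pred Carrier (c ⊔ ℓ) → Pred Carrier (c ⊔ ℓ) → Set (c ⊔ ℓ)
  Comparable P Q = P ⊊ Q ⊎ Q ⊊ P

  Adjacent : Pred Carrier (c ⊔ ℓ) → Pred Carrier (c ⊔ ℓ) → Set (c ⊔ ℓ)
  Adjacent P Q = ¬ (P ≐′ Q) × Comparable P Q

  Whole : Pred Carrier (c ⊔ ℓ)
  Whole = mem (whole S)

  ⊆∧⊉⇒⊊ : P ⊆′ Q → ¬ (Q ⊆′ P) → P ⊊ Q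
  ⊆∧⊉⇒⊊ P⊆Q Q⊈P = P⊆Q , Q⊈P ∘ proj₂

  ⊊-respˡ-≐′ : P ≐′ Q → P ⊊ R → Q ⊊ R
  ⊊-respˡ-≐′ P≐Q (P⊆R , P≉R) = ⊆′-trans (proj₂ P≐Q) P⊆R , P≉R ∘ ≐′-trans P≐Q

  ⊊-respʳ-≐′ : Q ≐′ R → P ⊊ Q → P ⊊ R
  ⊊-respʳ-≐′ Q≐R (P⊆Q , P≉Q) = ⊆′-trans P⊆Q (proj₁ Q≐R) , λ P≐R → P≉Q (≐′-trans P≐R (≐′-sym Q≐R))

  comparable⇒adjacent : Comparable P Q → Adjacent P Q
  comparable⇒adjacent P<>Q = [ proj₂ , (_∘ ≐′-sym) ∘ proj₂ ] P<>Q , P<>Q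

  adjacent-sym : Adjacent P Q → Adjacent Q P
  adjacent-sym = comparable⇒adjacent ∘ Sum.swap ∘ proj₂

  adjacent-respˡ-≐′ : P ≐′ Q → Adjacent P R → Adjacent Q R
  adjacent-respˡ-≐′ P≐Q = comparable⇒adjacent ∘ Sum.map (⊊-respˡ-≐′ P≐Q) (⊊-respʳ-≐′ P≐Q) ∘ proj₂

  whole⊆⇒≐whole : Whole ⊆′ P → P ≐′ Whole
  whole⊆⇒≐whole S⊆P = (λ _ _ → lift _) , S⊆P

  ⊆-proper : P ⊆′ Q → ¬ (Q ≐′ Whole) → ¬ (P ≐′ Whole)
  ⊆-proper P⊆Q Q≉S P≐S = Q≉S (whole⊆⇒≐whole (⊆′-trans (proj₂ P≐S) P⊆Q))

  ∪-least : P ⊆′ R → Q ⊆′ R → P ∪ Q ⊆′ R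
  ∪-least P⊆R Q⊆R x = [ P⊆R x , Q⊆R x ]

  cover⇒meets : Whole ⊆′ P ∪ Q → ¬ (R ⊆′ Q) → ¬ ¬ Satisfiable (R ∩ P)
  cover⇒meets S⊆P∪Q R⊈Q disjoint = R⊈Q λ x x∈R →
    [ (λ x∈P → ⊥-elim (disjoint (x , x∈R , x∈P))) , id ] (S⊆P∪Q x (lift _))

  LeftClosed : Pred Carrier (c ⊔ ℓ) → Set (c ⊔ ℓ)
  LeftClosed P = ∀ s x → P x → P (s ∙ x)

  ∪-leftClosed : LeftClosed P → LeftClosed Q → LeftClosed (P ∪ Q)
  ∪-leftClosed closedP closedQ s x = Sum.map (closedP s x) (closedQ s x)

  ∩-leftClosed : LeftClosed P → LeftClosed Q → LeftClosed (P ∩ Q)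
  ∩-leftClosed closedP closedQ s x (x∈P , x∈Q) = closedP s x x∈P , closedQ s x x∈Q

  infixr 6 _∪ˢ_ _∩ˢ_
  _∪ˢ_ _∩ˢ_ : Subset S → Subset S → Subset S
  A ∪ˢ B = record
    { mem  = mem A ∪ mem B
    ; resp = λ x≈y → Sum.map (resp A x≈y) (resp B x≈y)
    }
  A ∩ˢ B = record
    { mem  = mem A ∩ mem B
    ; resp = λ x≈y (x∈A , x∈B) → resp A x≈y x∈A , resp B x≈y x∈B
    }

  joinVertex : (U V : Vertex S) → ¬ (mem (ideal U) ∪ mem (ideal V) ≐′ Whole) → Vertex S
  joinVertex U V = vertex (ideal U ∪ˢ ideal V)
    (map₂ inj₁ (proj₁ (isLeftId U)) , ∪-leftClosed (proj₂ (isLeftId U)) (proj₂ (isLeftId V)))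

  meetVertex : (U V : Vertex S) → Satisfiable (mem (ideal U) ∩ mem (ideal V)) → Vertex S
  meetVertex U V nonEmpty = vertex (ideal U ∩ˢ ideal V)
    (nonEmpty , ∩-leftClosed (proj₂ (isLeftId U)) (proj₂ (isLeftId V)))
    (⊆-proper (λ _ → proj₁) (nontrivial U))

  open StarReasoning (Adj S)

  infix 4 _~_
  _~_ : Vertex S → Vertex S → Set (suc (c ⊔ ℓ))
  U ~ V = ¬ ¬ Path S U V

  ~-sym : {U V : Vertex S} → U ~ V → V ~ U
  ~-sym U~V ¬V⇝U = U~V (¬V⇝U ∘ reverse adjacent-sym)

  ~-trans : {U V W : Vertex S} → U ~ V → V ~ W → U ~ W
  ~-trans U~V V~W ¬U⇝W = U~V λ U⇝V → V~W λ V⇝W → ¬U⇝W (U⇝V ◅◅ V⇝W)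

  ⊆-neighbour⇒~ : (U V W : Vertex S) → Adj S V W → mem (ideal U) ⊆′ mem (ideal V) → U ~ V
  ⊆-neighbour⇒~ U V W V-W U⊆V = byCases λ where
    (yes U≐V) → contradiction
      (begin U ⟶⟨ adjacent-respˡ-≐′ (≐′-sym U≐V) V-W ⟩ W ⟶⟨ adjacent-sym V-W ⟩ V ∎)
    (no U≉V)  → contradiction (begin U ⟶⟨ comparable⇒adjacent (inj₁ (U⊆V , U≉V)) ⟩ V ∎)

  joinable⇒~ : (I J W : Vertex S) → mem (ideal I) ⊊ mem (ideal J) →
               ¬ (mem (ideal W) ∪ mem (ideal I) ≐′ Whole) → W ~ I
  joinable⇒~ I J W I⊊J proper = byCases compareIU
    where
    U : Vertex S
    U = joinVertex W I proper
    W⊆U : mem (ideal W) ⊆′ mem (ideal U)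
    W⊆U _ = inj₁
    I⊆U : mem (ideal I) ⊆′ mem (ideal U)
    I⊆U _ = inj₂
    compareIU : Dec (mem (ideal I) ≐′ mem (ideal U)) → W ~ I
    compareIU (yes I≐U) =
      ⊆-neighbour⇒~ W I J (comparable⇒adjacent (inj₁ I⊊J)) (⊆′-trans W⊆U (proj₂ I≐U))
    compareIU (no I≉U) =
      ~-trans (⊆-neighbour⇒~ W U I U-I W⊆U) (contradiction (begin U ⟶⟨ U-I ⟩ I ∎))
      where
      U-I : Adj S U I
      U-I = comparable⇒adjacent (inj₂ (I⊆U , I≉U))

  covering⇒~ : (I J W : Vertex S) → mem (ideal I) ⊊ mem (ideal J) →
               Whole ⊆′ mem (ideal W) ∪ mem (ideal I) → W ~ I
  covering⇒~ I J W (I⊆J , I≉J) S⊆W∪I ¬W⇝I =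
    cover⇒meets S⊆W∪I (λ J⊆I → I≉J (I⊆J , J⊆I)) (¬W⇝I ∘ pathThroughMeet)
    where
    pathThroughMeet : Satisfiable (mem (ideal J) ∩ mem (ideal W)) → Path S W I
    pathThroughMeet nonEmpty = begin
        W ⟶⟨ comparable⇒adjacent (inj₂ K⊊W) ⟩
        K ⟶⟨ comparable⇒adjacent (inj₁ K⊊J) ⟩
        J ⟶⟨ comparable⇒adjacent (inj₂ (I⊆J , I≉J)) ⟩
        I ∎
      where
      K : Vertex S
      K = meetVertex J W nonEmpty
      K⊊W : mem (ideal K) ⊊ mem (ideal W)
      K⊊W = ⊆∧⊉⇒⊊ (λ _ → proj₂) λ W⊆K →
        nontrivial J (whole⊆⇒≐whole (⊆′-trans S⊆W∪I (∪-least (λ x → proj₁ ∘ W⊆K x) I⊆J)))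
      K⊊J : mem (ideal K) ⊊ mem (ideal J)
      K⊊J = ⊆∧⊉⇒⊊ (λ _ → proj₁) λ J⊆K →
        nontrivial W (whole⊆⇒≐whole (⊆′-trans S⊆W∪I (∪-least (λ _ → id) (λ x → proj₂ ∘ J⊆K x ∘ I⊆J x))))

  ⊊⇒~ : (I J : Vertex S) → mem (ideal I) ⊊ mem (ideal J) → (W : Vertex S) → W ~ I
  ⊊⇒~ I J I⊊J W = byCases λ where
    (yes W∪I≐S) → covering⇒~ I J W I⊊J (proj₂ W∪I≐S)
    (no W∪I≉S)  → joinable⇒~ I J W I⊊J W∪I≉S

mainTheorem20 : ∀ {c ℓ : Level} (S : Semigroup c ℓ) → Disconnected S → NoEdges S
mainTheorem20 S (U , V , ¬U⇝V) I J (_ , I<>J) = [ noProperInclusion I J , noProperInclusion J I ] I<>J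
  where
  open InclusionIdealGraph S
  noProperInclusion : (I J : Vertex S) → mem (ideal I) ⊊ mem (ideal J) → ⊥
  noProperInclusion I J I⊊J = ~-trans (⊊⇒~ I J I⊊J U) (~-sym (⊊⇒~ I J I⊊J V)) ¬U⇝V
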